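{- Let $G$ be a complementary vanishing graph. (1) If $G$ has no dominating vertices, then $G$ is $\alpha$-robust. (2) If $G$ has no isolated vertices, then $G$ is $\beta$-robust.
   Context: For a graph $G$ with vertex set $\{v_1,\dots,v_n\}$, $\mathcal{S}(G)$ is the set of real symmetric $n\times n$ matrices $A=[a_{i,j}]$ such that for $i\neq j$, $a_{i,j}\neq 0$ if and only if $v_iv_j\in E(G)$ (diagonal entries are unrestricted). $\overline{G}$ is the complement of $G$. $G$ is complementary vanishing if there exist $A\in\mathcal{S}(G)$, $B\in\mathcal{S}(\overline{G})$ with $AB=O$. $G$ is $\alpha$-robust if there exist such $A,B$ with $AB=O$ and $\ker(A)$ containing a nowhere-zero vector (all entries nonzero); $G$ is $\beta$-robust if there exist such $A,B$ with $AB=O$ and $\ker(B)$ containing a nowhere-zero vector. A dominating vertex is adjacent to all other vertices. -}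

module Defs where

open import Level using (0ℓ)
open import Data.Nat using (ℕ; zero; suc)
open import Data.Fin using (Fin; zero; suc)
open import Data.Fin.Properties using (_≟_)
open import Data.Bool using (Bool; true; false; not; _∧_)
open import Data.Product using (Σ; ∃; _×_; _,_)
open import Relation.Nullary using (¬_; ⌊_⌋)
open import Relation.Binary.PropositionalEquality using (_≡_; _≢_)
open import Relation.Binary.Structures using (IsStrictTotalOrder)
open import Algebra.Bundles using (CommutativeRing)

-- The real numbers, given axiomatically: a Dedekind-complete ordered
-- field (unique up to isomorphism, so this is ℝ).

record RealField : Set₁ where
  field
    commRing : CommutativeRing 0ℓ 0ℓ
  open CommutativeRing commRing public hiding (ring)
  field
    _<_          : Carrier → Carrier → Set
    nontrivial   : ¬ (1# ≈ 0#)
    inverse      : ∀ x → ¬ (x ≈ 0#) → ∃ λ y → x * y ≈ 1#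
    isSTO        : IsStrictTotalOrder _≈_ _<_
    +-mono-<     : ∀ x y z → x < y → (x + z) < (y + z)
    *-pos        : ∀ x y → 0# < x → 0# < y → 0# < (x * y)
    lub          : (S : Carrier → Set) → (∃ λ x → S x) →
                   (∃ λ b → ∀ x → S x → ¬ (b < x)) →
                   ∃ λ s → (∀ x → S x → ¬ (s < x)) ×
                           (∀ b → (∀ x → S x → ¬ (b < x)) → ¬ (b < s))

record Graph (n : ℕ) : Set where
  field
    adj       : Fin n → Fin n → Bool
    adj-sym   : ∀ i j → adj i j ≡ adj j i
    adj-irr   : ∀ i → adj i i ≡ false
open Graph public

complement : ∀ {n} → Graph n → Graph n
complement G = record
  { adj     = λ i j → not (adj G i j) ∧ not ⌊ i ≟ j ⌋
  ; adj-sym = sym'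
  ; adj-irr = irr
  }
  where
  open import Relation.Binary.PropositionalEquality using (refl; cong; sym)

  open import Relation.Nullary.Decidable using (dec-true; dec-false)
  irr : ∀ i → (not (adj G i i) ∧ not ⌊ i ≟ i ⌋) ≡ false
  irr i with i ≟ i
  ... | Relation.Nullary.yes _ = Data.Bool.Properties.∧-zeroʳ (not (adj G i i))
    where import Data.Bool.Properties
  ... | Relation.Nullary.no q = Data.Empty.⊥-elim (q refl)
    where import Data.Empty
  sym' : ∀ i j → (not (adj G i j) ∧ not ⌊ i ≟ j ⌋) ≡ (not (adj G j i) ∧ not ⌊ j ≟ i ⌋)
  sym' i j with i ≟ j | j ≟ i
  ... | Relation.Nullary.yes _ | Relation.Nullary.yes _ = cong (λ a → not a ∧ _) (adj-sym G i j)
  ... | Relation.Nullary.no _ | Relation.Nullary.no _ = cong (λ a → not a ∧ _) (adj-sym G i j)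
  ... | Relation.Nullary.yes p | Relation.Nullary.no q = Data.Empty.⊥-elim (q (sym p))
    where import Data.Empty
  ... | Relation.Nullary.no q | Relation.Nullary.yes p = Data.Empty.⊥-elim (q (sym p))
    where import Data.Empty

Dominating : ∀ {n} → Graph n → Fin n → Set
Dominating G i = ∀ j → i ≢ j → adj G i j ≡ true

Isolated : ∀ {n} → Graph n → Fin n → Set
Isolated G i = ∀ j → adj G i j ≡ false

module _ (ℝ : RealField) where
  open RealField ℝ using (Carrier; _≈_; 0#; _+_; _*_)

  Matrix : ℕ → Set
  Matrix n = Fin n → Fin n → Carrier

  Vector : ℕ → Set
  Vector n = Fin n → Carrier

  ∑ : ∀ {n} → (Fin n → Carrier) → Carrier
  ∑ {zero}  f = 0#
  ∑ {suc n} f = f zero + ∑ (λ k → f (suc k))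

  InS : ∀ {n} → Graph n → Matrix n → Set
  InS G A = (∀ i j → A i j ≈ A j i) ×
            (∀ i j → i ≢ j → (¬ (A i j ≈ 0#) → adj G i j ≡ true) ×
                             (adj G i j ≡ true → ¬ (A i j ≈ 0#)))

  ProdZero : ∀ {n} → Matrix n → Matrix n → Set
  ProdZero A B = ∀ i j → ∑ (λ k → A i k * B k j) ≈ 0#

  InKer : ∀ {n} → Matrix n → Vector n → Set
  InKer A x = ∀ i → ∑ (λ k → A i k * x k) ≈ 0#

  NowhereZero : ∀ {n} → Vector n → Set
  NowhereZero x = ∀ i → ¬ (x i ≈ 0#)

  ComplementaryVanishing : ∀ {n} → Graph n → Set
  ComplementaryVanishing G =
    Σ (Matrix _) λ A → Σ (Matrix _) λ B →
      InS G A × InS (complement G) B × ProdZero A B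

  αRobust : ∀ {n} → Graph n → Set
  αRobust G =
    Σ (Matrix _) λ A → Σ (Matrix _) λ B →
      InS G A × InS (complement G) B × ProdZero A B ×
      (Σ (Vector _) λ x → InKer A x × NowhereZero x)

  βRobust : ∀ {n} → Graph n → Set
  βRobust G =
    Σ (Matrix _) λ A → Σ (Matrix _) λ B →
      InS G A × InS (complement G) B × ProdZero A B ×
      (Σ (Vector _) λ x → InKer B x × NowhereZero x)

-- If A B = O then every column of B lies in ker A, and by symmetry every
-- column of A lies in ker B.  No dominating vertex in G means that every row
-- of B has a nonzero entry (at a non-neighbour), no isolated vertex that
-- every row of A does.  So it suffices that a subspace containing, for each
-- coordinate, a vector nonzero there also contains a nowhere-zero vector:
-- add the vectors one at a time, x ↦ x + s v, where for each coordinate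
-- only one value of s makes x + s v vanish there, and an ordered field has
-- a value of s above all of these finitely many roots.
module Submission where

open import Defs
open import Data.Nat using (ℕ; zero; suc)
open import Data.Fin using (Fin; zero; suc)
open import Data.Fin.Properties using (¬∀⟶∃¬) renaming (_≟_ to _≟ᶠ_)
open import Data.Bool using (true; false)
open import Data.Bool.Properties using (¬-not) renaming (_≟_ to _≟ᵇ_)
open import Data.List using (List; []; _∷_; allFin)
open import Data.List.Relation.Unary.All as All using (All; []; _∷_)
open import Data.List.Membership.Propositional.Properties using (∈-allFin)
open import Data.Product using (_×_; _,_; ∃; proj₁; proj₂)
open import Data.Sum using (_⊎_; inj₁; inj₂; [_,_])
open import Data.Empty using (⊥-elim)
open import Relation.Nullary using (¬_; yes; no)
open import Relation.Nullary.Decidable using (¬?; _→-dec_)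
open import Relation.Binary.PropositionalEquality as ≡ using (_≡_; _≢_)
open import Relation.Binary.Definitions using (tri<; tri≈; tri>)
open import Relation.Binary.Structures using (IsStrictTotalOrder)
open import Algebra.Bundles using (CommutativeRing)
import Algebra.Properties.CommutativeSemigroup as CommutativeSemigroupProperties
import Algebra.Properties.Ring as RingProperties
import Algebra.Properties.Semiring.Sum as SemiringSum

module _ (ℝ : RealField) where
  open RealField ℝ hiding (zero)
  open IsStrictTotalOrder isSTO
    using (compare; irrefl; asym; <-respˡ-≈; <-respʳ-≈) renaming (_≟_ to _≈?_; trans to <-trans)
  open RingProperties (CommutativeRing.ring commRing)
    using (-1*x≈-x; -‿involutive; -‿distribˡ-*; +-inverseʳ-unique)
  open SemiringSum (CommutativeRing.semiring commRing)
    using (sum; sum-cong-≋; sum-replicate-zero; ∑-distrib-+; *-distribˡ-sum)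
  open CommutativeSemigroupProperties (CommutativeRing.*-commutativeSemigroup commRing)
    using (x∙yz≈y∙xz)
  open import Relation.Binary.Reasoning.Setoid setoid

  0<1 : 0# < 1#
  0<1 with compare 0# 1#
  ... | tri< lt _ _ = lt
  ... | tri≈ _ 0≈1 _ = ⊥-elim (nontrivial (sym 0≈1))
  ... | tri> _ _ 1<0 = ⊥-elim (asym 1<0 (<-respʳ-≈ -1*-1≈1 (*-pos _ _ 0<-1 0<-1)))
    where
    0<-1 : 0# < (- 1#)
    0<-1 = <-respʳ-≈ (+-identityˡ _) (<-respˡ-≈ (-‿inverseʳ 1#) (+-mono-< 1# 0# (- 1#) 1<0))
    -1*-1≈1 : - 1# * - 1# ≈ 1#
    -1*-1≈1 = trans (-1*x≈-x (- 1#)) (-‿involutive 1#)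

  x<1+x : ∀ x → x < (1# + x)
  x<1+x x = <-respˡ-≈ (+-identityˡ x) (+-mono-< 0# 1# x 0<1)

  common-strict-upper-bound : ∀ x y → ∃ λ z → x < z × y < z
  common-strict-upper-bound x y with compare x y
  ... | tri< x<y _ _ = 1# + y , <-trans x<y (x<1+x y) , x<1+x y
  ... | tri≈ _ x≈y _ = 1# + y , <-respˡ-≈ (sym x≈y) (x<1+x y) , x<1+x y
  ... | tri> _ _ y<x = 1# + x , x<1+x x , <-trans y<x (x<1+x x)

  affine-root-unique : ∀ a b → (¬ a ≈ 0#) ⊎ (¬ b ≈ 0#) →
                       ∃ λ t → ∀ s → a + s * b ≈ 0# → s ≈ t
  affine-root-unique a b a≉0⊎b≉0 with b ≈? 0#
  ... | yes b≈0 = 0# , λ s root →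
    ⊥-elim ([ (λ a≉0 → a≉0 (trans (sym (a+sb≈a s)) root)) , (λ b≉0 → b≉0 b≈0) ] a≉0⊎b≉0)
    where
    a+sb≈a : ∀ s → a + s * b ≈ a
    a+sb≈a s = begin
      a + s * b   ≈⟨ +-congˡ (trans (*-congˡ b≈0) (zeroʳ s)) ⟩
      a + 0#      ≈⟨ +-identityʳ a ⟩
      a           ∎
  ... | no b≉0 with inverse b b≉0
  ... | b⁻¹ , bb⁻¹≈1 = - (a * b⁻¹) , λ s root → begin
    s               ≈⟨ sym (*-identityʳ s) ⟩
    s * 1#          ≈⟨ *-congˡ (sym bb⁻¹≈1) ⟩
    s * (b * b⁻¹)   ≈⟨ sym (*-assoc s b b⁻¹) ⟩
    s * b * b⁻¹     ≈⟨ *-congʳ (+-inverseʳ-unique a (s * b) root) ⟩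
    - a * b⁻¹       ≈⟨ sym (-‿distribˡ-* a b⁻¹) ⟩
    - (a * b⁻¹)     ∎

  eventually-nonzero : {X : Set} (a b : X → Carrier) (cs : List X) →
                       All (λ c → (¬ a c ≈ 0#) ⊎ (¬ b c ≈ 0#)) cs →
                       ∃ λ u → ∀ s → u < s → All (λ c → ¬ a c + s * b c ≈ 0#) cs
  eventually-nonzero a b [] [] = 0# , λ _ _ → []
  eventually-nonzero a b (c ∷ cs) (nz ∷ nzs)
    with affine-root-unique (a c) (b c) nz | eventually-nonzero a b cs nzs
  ... | t , root≈t | u , large with common-strict-upper-bound t u
  ... | w , t<w , u<w = w , λ s w<s →
    (λ root → irrefl (sym (root≈t s root)) (<-trans t<w w<s)) ∷ large s (<-trans u<w w<s)

  ∑≡sum : ∀ {n} (f : Fin n → Carrier) → ∑ ℝ f ≡ sum f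
  ∑≡sum {zero}  f = ≡.refl
  ∑≡sum {suc n} f = ≡.cong (f zero +_) (∑≡sum (λ k → f (suc k)))

  ∑-cong : ∀ {n} {f g : Fin n → Carrier} → (∀ k → f k ≈ g k) → ∑ ℝ f ≈ ∑ ℝ g
  ∑-cong {f = f} {g} f≈g = begin
    ∑ ℝ f   ≡⟨ ∑≡sum f ⟩
    sum f   ≈⟨ sum-cong-≋ f≈g ⟩
    sum g   ≡⟨ ∑≡sum g ⟨
    ∑ ℝ g   ∎

  InKer-zero : ∀ {n} (N : Matrix ℝ n) → InKer ℝ N (λ _ → 0#)
  InKer-zero {n} N i = begin
    ∑ ℝ (λ k → N i k * 0#)   ≈⟨ ∑-cong (λ k → zeroʳ (N i k)) ⟩
    ∑ ℝ {n} (λ _ → 0#)       ≡⟨ ∑≡sum {n} _ ⟩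
    sum {n} (λ _ → 0#)       ≈⟨ sum-replicate-zero n ⟩
    0#                       ∎

  InKer-+-* : ∀ {n} (N : Matrix ℝ n) {x v : Vector ℝ n} s →
              InKer ℝ N x → InKer ℝ N v → InKer ℝ N (λ k → x k + s * v k)
  InKer-+-* {n} N {x} {v} s Nx≈0 Nv≈0 i = begin
    ∑ ℝ (λ k → N i k * (x k + s * v k))
      ≈⟨ ∑-cong (λ k → trans (distribˡ _ _ _) (+-congˡ (x∙yz≈y∙xz (N i k) s (v k)))) ⟩
    ∑ ℝ (λ k → N i k * x k + s * (N i k * v k))
      ≡⟨ ∑≡sum {n} _ ⟩
    sum (λ k → N i k * x k + s * (N i k * v k))
      ≈⟨ ∑-distrib-+ {n} _ _ ⟩
    sum (λ k → N i k * x k) + sum (λ k → s * (N i k * v k))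
      ≈⟨ +-congˡ (*-distribˡ-sum {n} s _) ⟨
    sum (λ k → N i k * x k) + s * sum (λ k → N i k * v k)
      ≡⟨ ≡.cong₂ (λ y z → y + s * z) (∑≡sum {n} _) (∑≡sum {n} _) ⟨
    ∑ ℝ (λ k → N i k * x k) + s * ∑ ℝ (λ k → N i k * v k)
      ≈⟨ +-cong (Nx≈0 i) (*-congˡ (Nv≈0 i)) ⟩
    0# + s * 0#
      ≈⟨ trans (+-identityˡ _) (zeroʳ s) ⟩
    0# ∎

  kernel-vector-nonzero-on : ∀ {n} (N : Matrix ℝ n) {J : Set} (V : J → Vector ℝ n) →
    (∀ j → InKer ℝ N (V j)) → (∀ i → ∃ λ j → ¬ V j i ≈ 0#) →
    (is : List (Fin n)) → ∃ λ x → InKer ℝ N x × All (λ i → ¬ x i ≈ 0#) is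
  kernel-vector-nonzero-on N V V∈ker V-covers [] = (λ _ → 0#) , InKer-zero N , []
  kernel-vector-nonzero-on N V V∈ker V-covers (i ∷ is)
    with kernel-vector-nonzero-on N V V∈ker V-covers is | V-covers i
  ... | x , x∈ker , x≉0 | j , Vji≉0
    with eventually-nonzero x (V j) (i ∷ is) (inj₂ Vji≉0 ∷ All.map inj₁ x≉0)
  ... | u , large = (λ k → x k + (1# + u) * V j k) ,
                    InKer-+-* N (1# + u) x∈ker (V∈ker j) ,
                    large (1# + u) (x<1+x u)

  kernel-nowhere-zero : ∀ {n} (N : Matrix ℝ n) {J : Set} (V : J → Vector ℝ n) →
    (∀ j → InKer ℝ N (V j)) → (∀ i → ∃ λ j → ¬ V j i ≈ 0#) →
    ∃ λ x → InKer ℝ N x × NowhereZero ℝ x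
  kernel-nowhere-zero {n} N V V∈ker V-covers
    with kernel-vector-nonzero-on N V V∈ker V-covers (allFin n)
  ... | x , x∈ker , x≉0 = x , x∈ker , λ i → All.lookup x≉0 (∈-allFin i)

  ProdZero-transpose : ∀ {n} {A B : Matrix ℝ n} →
    (∀ i j → A i j ≈ A j i) → (∀ i j → B i j ≈ B j i) →
    ProdZero ℝ A B → ProdZero ℝ B A
  ProdZero-transpose {A = A} {B} A-sym B-sym AB≈0 i j = begin
    ∑ ℝ (λ k → B i k * A k j)   ≈⟨ ∑-cong (λ k → trans (*-comm _ _) (*-cong (A-sym k j) (B-sym i k))) ⟩
    ∑ ℝ (λ k → A j k * B k i)   ≈⟨ AB≈0 j i ⟩
    0#                          ∎

  InS-row-nonzero : ∀ {n} (G : Graph n) {A : Matrix ℝ n} → InS ℝ G A →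
    (∀ i → ∃ λ j → i ≢ j × adj G i j ≡ true) → ∀ i → ∃ λ j → ¬ A i j ≈ 0#
  InS-row-nonzero G (_ , A-pattern) neighbour i with neighbour i
  ... | j , i≢j , ij∈G = j , proj₂ (A-pattern i j i≢j) ij∈G

complement-adjacent : ∀ {n} (G : Graph n) {i j} → i ≢ j → adj G i j ≡ false →
  adj (complement G) i j ≡ true
complement-adjacent G {i} {j} i≢j ij∉G with i ≟ᶠ j
... | yes i≡j = ⊥-elim (i≢j i≡j)
... | no _ rewrite ij∉G = ≡.refl

¬Dominating⇒non-neighbour : ∀ {n} (G : Graph n) i → ¬ Dominating G i →
  ∃ λ j → i ≢ j × adj G i j ≡ false
¬Dominating⇒non-neighbour G i ¬dom
  with ¬∀⟶∃¬ _ _ (λ j → ¬? (i ≟ᶠ j) →-dec adj G i j ≟ᵇ true) ¬dom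
... | j , ¬dominates-j =
  j , (λ i≡j → ¬dominates-j (λ i≢j → ⊥-elim (i≢j i≡j))) ,
      ¬-not (λ ij∈G → ¬dominates-j (λ _ → ij∈G))

¬Dominating⇒complement-neighbour : ∀ {n} (G : Graph n) i → ¬ Dominating G i →
  ∃ λ j → i ≢ j × adj (complement G) i j ≡ true
¬Dominating⇒complement-neighbour G i ¬dom with ¬Dominating⇒non-neighbour G i ¬dom
... | j , i≢j , ij∉G = j , i≢j , complement-adjacent G i≢j ij∉G

¬Isolated⇒neighbour : ∀ {n} (G : Graph n) i → ¬ Isolated G i →
  ∃ λ j → i ≢ j × adj G i j ≡ true
¬Isolated⇒neighbour G i ¬iso with ¬∀⟶∃¬ _ _ (λ j → adj G i j ≟ᵇ false) ¬iso
... | j , adj≢false = j , (λ { ≡.refl → adj≢false (adj-irr G i) }) , ¬-not adj≢false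

lemma3p3 : (ℝ : RealField) (n : ℕ) (G : Graph n) →
    ComplementaryVanishing ℝ G →
    ((∀ (i : Fin n) → ¬ Dominating G i) → αRobust ℝ G) ×
    ((∀ (i : Fin n) → ¬ Isolated G i) → βRobust ℝ G)
lemma3p3 ℝ n G (A , B , A∈S , B∈S , AB≈0) = α-robust , β-robust
  where
  α-robust : (∀ i → ¬ Dominating G i) → αRobust ℝ G
  α-robust ¬dom = A , B , A∈S , B∈S , AB≈0 ,
    kernel-nowhere-zero ℝ A (λ j k → B k j) (λ j i → AB≈0 i j)
      (InS-row-nonzero ℝ (complement G) B∈S (λ i → ¬Dominating⇒complement-neighbour G i (¬dom i)))

  β-robust : (∀ i → ¬ Isolated G i) → βRobust ℝ G
  β-robust ¬iso = A , B , A∈S , B∈S , AB≈0 ,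
    kernel-nowhere-zero ℝ B (λ j k → A k j)
      (λ j i → ProdZero-transpose ℝ (proj₁ A∈S) (proj₁ B∈S) AB≈0 i j)
      (InS-row-nonzero ℝ G A∈S (λ i → ¬Isolated⇒neighbour G i (¬iso i)))
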